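{- For every table $T\in\mathcal{M}_k^2\setminus\{\Lambda\}$, $N(T)\le(kW(T))^{S(T)}$.
   Context: Fix an integer $k\ge 2$; $E_k=\{0,\ldots,k-1\}$, $E_2=\{0,1\}$, $P=\{f_i:i\in\{0,1,2,\ldots\}\}$ a set of attribute names. $\mathcal{M}_k^2$ is the set of rectangular tables filled with numbers from $E_k$, columns labeled with pairwise different attributes from $P$, rows pairwise different, each row labeled with a decision from $E_2$; the table without rows is denoted $\Lambda$. $P(T)$ is the set of column attributes. $N(T)$ is the number of rows and $W(T)$ the number of columns of $T$. For a row $\bar\delta$ of $T$, $S(T,\bar\delta)$ is the minimum cardinality of a set $D\subseteq P(T)$ such that on the columns labeled by attributes of $D$ the row $\bar\delta$ differs from all other rows of $T$; $S(T)=\max_{\bar\delta}S(T,\bar\delta)$. The convention $0^0=1$ is used. -}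

module Defs where

open import Data.Nat using (ℕ; _≤_)
open import Data.Fin using (Fin)
open import Data.Fin.Subset using (Subset; _∈_; ∣_∣)
open import Data.Vec using (Vec; lookup)
open import Data.List using (List; map; length)
import Data.List.Membership.Propositional as LM
open import Data.List.Relation.Unary.Unique.Propositional using (Unique)
open import Data.Product using (_×_; Σ; ∃; proj₁)
open import Data.Bool using (Bool)
open import Relation.Binary.PropositionalEquality using (_≡_; _≢_)

-- Decisions from E₂ = {0,1} are represented by Bool; values from E_k by Fin k.
-- Attribute f_i is represented by its index i : ℕ.

record Table (k : ℕ) : Set where
  field
    m      : ℕ
    attrs  : Vec ℕ m
    attrs-distinct : ∀ i j → lookup attrs i ≡ lookup attrs j → i ≡ j
    rows   : List (Vec (Fin k) m × Bool)
    rows-distinct : Unique (map proj₁ rows)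
open Table public

W : ∀ {k} → Table k → ℕ
W T = m T

N : ∀ {k} → Table k → ℕ
N T = length (rows T)

Rows : ∀ {k} (T : Table k) → List (Vec (Fin k) (m T))
Rows T = map proj₁ (rows T)

Separates : ∀ {k} (T : Table k) → Subset (m T) → Vec (Fin k) (m T) → Set
Separates T D δ = ∀ δ' → δ' LM.∈ Rows T → δ' ≢ δ →
  ∃ λ i → (i ∈ D) × (lookup δ i ≢ lookup δ' i)

IsSrow : ∀ {k} (T : Table k) → Vec (Fin k) (m T) → ℕ → Set
IsSrow T δ s =
  (Σ (Subset (m T)) λ D → Separates T D δ × ∣ D ∣ ≡ s) ×
  (∀ D → Separates T D δ → s ≤ ∣ D ∣)

IsS : ∀ {k} (T : Table k) → ℕ → Set
IsS T s =
  (Σ (Vec _ (m T)) λ δ → δ LM.∈ Rows T × IsSrow T δ s) ×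
  (∀ δ → δ LM.∈ Rows T → ∀ t → IsSrow T δ t → t ≤ s)

{-# OPTIONS --safe #-}
module Submission where

open import Defs
open import Data.Nat using (ℕ; _≤_; _*_; _^_)
open import Relation.Binary.PropositionalEquality using (_≢_)
open import Data.List using ([])

-- Give every row δ a separating set D_δ of size S(T, δ) ≤ S(T) = s and list the
-- columns of D_δ (with repetitions) as c₁, …, c_s.  The row is then coded by the word
-- (δ(c₁), c₁) ⋯ (δ(c_s), c_s) over the alphabet E_k × P(T) of size k W(T).  Two rows
-- with the same code agree on D_δ, so they coincide because D_δ separates δ; hence
-- the coding is injective and N(T) ≤ (k W(T))^s.

open import Data.Nat using (zero; suc; _<_; _≤?_; z≤n; s≤s)
open import Data.Nat.Properties using (≤-refl; ≤-trans; ≤-pred; ≮⇒≥; n≤0⇒n≡0; m≤n⇒m<n∨m≡n)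
open import Data.Fin using (Fin; combine; funToFin; finToFun)
  renaming (zero to fzero; suc to fsuc; _≟_ to _≟ᶠ_)
open import Data.Fin.Properties
  using (any?; ¬∀⟶∃¬; injective⇒≤; combine-injective; finToFun-funToFin)
open import Data.Fin.Subset using (Subset; inside; outside; ∣_∣; ⊤) renaming (_∈_ to _∈ₛ_)
open import Data.Fin.Subset.Properties using (_∈?_; ∈⊤; ∣p∣≤n; anySubset?)
open import Data.Vec using (Vec; lookup; here; there) renaming (_∷_ to _∷ᵥ_; [] to []ᵥ)
open import Data.Vec.Properties using (≡-dec; tabulate∘lookup; tabulate-cong)
open import Data.List using (List; length)
import Data.List as List
open import Data.List.Properties using (length-map)
open import Data.List.Membership.Propositional using (_∈_)
open import Data.List.Membership.Propositional.Properties using (∈-lookup)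
import Data.List.Relation.Unary.All as All
open import Data.List.Relation.Unary.AllPairs using (_∷_)
open import Data.List.Relation.Unary.Unique.Propositional using (Unique)
open import Data.Product using (Σ; ∃; _×_; _,_; proj₁; proj₂)
open import Data.Sum using (inj₁; inj₂)
open import Function using (id)
open import Relation.Nullary using (Dec; yes; no; ¬?; contradiction)
open import Relation.Nullary.Decidable using (_→-dec_; _×-dec_)
open import Relation.Unary using (Pred; Decidable)
open import Relation.Binary.PropositionalEquality using (_≡_; refl; sym; trans; cong; subst)

Unique-lookup-injective : ∀ {A : Set} {xs : List A} → Unique xs →
  ∀ i j → List.lookup xs i ≡ List.lookup xs j → i ≡ j
Unique-lookup-injective (_ ∷ _)       fzero    fzero    _  = refl
Unique-lookup-injective (x∉xs ∷ _)    fzero    (fsuc j) eq = contradiction eq (All.lookup x∉xs (∈-lookup j))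
Unique-lookup-injective (x∉xs ∷ _)    (fsuc i) fzero    eq = contradiction (sym eq) (All.lookup x∉xs (∈-lookup i))
Unique-lookup-injective (_ ∷ unique) (fsuc i) (fsuc j) eq = cong fsuc (Unique-lookup-injective unique i j eq)

Unique⇒length≤ : ∀ {A : Set} {xs : List A} {n} → Unique xs →
  (f : Fin (length xs) → Fin n) →
  (∀ {i j} → f i ≡ f j → List.lookup xs i ≡ List.lookup xs j) → length xs ≤ n
Unique⇒length≤ unique f f-determines =
  injective⇒≤ (λ {i} {j} eq → Unique-lookup-injective unique i j (f-determines eq))

funToFin-injective : ∀ {m n} (f g : Fin m → Fin n) → funToFin f ≡ funToFin g → ∀ i → f i ≡ g i
funToFin-injective f g eq i =
  trans (sym (finToFun-funToFin f i)) (trans (cong (λ c → finToFun c i) eq) (finToFun-funToFin g i))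

trace : ∀ {k m s} → Vec (Fin k) m → (Fin s → Fin m) → Fin s → Fin (k * m)
trace δ e q = combine (lookup δ (e q)) (e q)

trace-agrees : ∀ {k m s} (δ δ' : Vec (Fin k) m) (e e' : Fin s → Fin m) q →
  trace δ e q ≡ trace δ' e' q → lookup δ (e q) ≡ lookup δ' (e q)
trace-agrees δ δ' e e' q eq with combine-injective (lookup δ (e q)) (e q) (lookup δ' (e' q)) (e' q) eq
... | value≡ , column≡ = trans value≡ (cong (lookup δ') (sym column≡))

Covers : ∀ {s n} → (Fin s → Fin n) → Subset n → Set
Covers e p = ∀ {c} → c ∈ₛ p → ∃ λ q → e q ≡ c

∃-cover : ∀ {n s} (p : Subset n) → ∣ p ∣ ≤ s → s ≤ n → Σ (Fin s → Fin n) λ e → Covers e p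
∃-cover []ᵥ _ z≤n = (λ ()) , λ ()
∃-cover (inside ∷ᵥ p) (s≤s ∣p∣≤s) (s≤s s≤n) with ∃-cover p ∣p∣≤s s≤n
... | e , covers = extend , cover
  where
  extend : Fin _ → Fin _
  extend fzero    = fzero
  extend (fsuc q) = fsuc (e q)
  cover : Covers extend (inside ∷ᵥ p)
  cover here        = fzero , refl
  cover (there c∈p) with covers c∈p
  ... | q , refl = fsuc q , refl
∃-cover (outside ∷ᵥ p) ∣p∣≤s s≤1+n with m≤n⇒m<n∨m≡n s≤1+n
... | inj₂ refl = id , λ {c} _ → c , refl
... | inj₁ (s≤s s≤n) with ∃-cover p ∣p∣≤s s≤n
...   | e , covers = (λ q → fsuc (e q)) , cover
  where
  cover : Covers (λ q → fsuc (e q)) (outside ∷ᵥ p)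
  cover (there c∈p) with covers c∈p
  ... | q , refl = q , refl

module _ {n ℓ} {P : Pred (Subset n) ℓ} (P? : Decidable P) where

  IsMinimumSize : ℕ → Set ℓ
  IsMinimumSize s = (Σ (Subset n) λ D → P D × ∣ D ∣ ≡ s) × (∀ D → P D → s ≤ ∣ D ∣)

  ∃-minimumSize : ∀ {D} → P D → ∃ IsMinimumSize
  ∃-minimumSize {D} PD = descend ∣ D ∣ D PD ≤-refl
    where
    descend : ∀ b D → P D → ∣ D ∣ ≤ b → ∃ IsMinimumSize
    descend zero    D PD ∣D∣≤0 = 0 , (D , PD , n≤0⇒n≡0 ∣D∣≤0) , λ _ _ → z≤n
    descend (suc b) D PD ∣D∣≤1+b
      with anySubset? {P = λ D' → P D' × ∣ D' ∣ < ∣ D ∣} (λ D' → P? D' ×-dec (suc ∣ D' ∣ ≤? ∣ D ∣))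
    ... | yes (D' , PD' , ∣D'∣<∣D∣) = descend b D' PD' (≤-pred (≤-trans ∣D'∣<∣D∣ ∣D∣≤1+b))
    ... | no ∄smaller = ∣ D ∣ , (D , PD , refl) , λ D' PD' → ≮⇒≥ (λ lt → ∄smaller (D' , PD' , lt))

∃-lookup-≢ : ∀ {k m} {x y : Vec (Fin k) m} → x ≢ y → ∃ λ i → lookup x i ≢ lookup y i
∃-lookup-≢ {x = x} {y} x≢y = ¬∀⟶∃¬ _ _ (λ i → lookup x i ≟ᶠ lookup y i) (λ same → x≢y (lookup-ext same))
  where
  lookup-ext : (∀ i → lookup x i ≡ lookup y i) → x ≡ y
  lookup-ext same = trans (sym (tabulate∘lookup x)) (trans (tabulate-cong same) (tabulate∘lookup y))

module _ {k : ℕ} (T : Table k) where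

  Separates? : ∀ D δ → Dec (Separates T D δ)
  Separates? D δ
    with All.all? (λ δ' → ¬? (≡-dec _≟ᶠ_ δ' δ) →-dec
                    any? (λ i → (i ∈? D) ×-dec ¬? (lookup δ i ≟ᶠ lookup δ' i))) (Rows T)
  ... | yes separated = yes (λ δ' δ'∈T δ'≢δ → All.lookup separated δ'∈T δ'≢δ)
  ... | no ¬separated = no (λ sep → ¬separated (All.tabulate (λ {δ'} δ'∈T → sep δ' δ'∈T)))

  ⊤-separates : ∀ δ → Separates T ⊤ δ
  ⊤-separates δ δ' _ δ'≢δ with ∃-lookup-≢ (λ δ≡δ' → δ'≢δ (sym δ≡δ'))
  ... | i , differ = i , ∈⊤ , differ

  ∃-Srow : ∀ δ → ∃ (IsSrow T δ)
  ∃-Srow δ = ∃-minimumSize (λ D → Separates? D δ) (⊤-separates δ)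

  agree-on-separating⇒≡ : ∀ {D δ δ'} → Separates T D δ → δ' ∈ Rows T →
    (∀ {c} → c ∈ₛ D → lookup δ c ≡ lookup δ' c) → δ ≡ δ'
  agree-on-separating⇒≡ {δ = δ} {δ'} sep δ'∈T agree with ≡-dec _≟ᶠ_ δ' δ
  ... | yes δ'≡δ = sym δ'≡δ
  ... | no δ'≢δ with sep δ' δ'∈T δ'≢δ
  ...   | c , c∈D , differ = contradiction (agree c∈D) differ

  module _ {s} (s≤W : s ≤ W T) (S≤s : ∀ δ → δ ∈ Rows T → ∀ t → IsSrow T δ t → t ≤ s) where

    private
      row : Fin (length (Rows T)) → Vec (Fin k) (W T)
      row = List.lookup (Rows T)

      separating : ∀ i → Σ (Subset (W T)) λ D → Separates T D (row i) × ∣ D ∣ ≤ s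
      separating i with ∃-Srow (row i)
      ... | t , S@((D , D-separates , ∣D∣≡t) , _) =
        D , D-separates , subst (_≤ s) (sym ∣D∣≡t) (S≤s (row i) (∈-lookup i) t S)

      D : Fin (length (Rows T)) → Subset (W T)
      D i = proj₁ (separating i)

      columns : ∀ i → Σ (Fin s → Fin (W T)) λ e → Covers e (D i)
      columns i = ∃-cover (D i) (proj₂ (proj₂ (separating i))) s≤W

      code : Fin (length (Rows T)) → Fin ((k * W T) ^ s)
      code i = funToFin (trace (row i) (proj₁ (columns i)))

      code-determines : ∀ {i j} → code i ≡ code j → row i ≡ row j
      code-determines {i} {j} eq = agree-on-separating⇒≡ (proj₁ (proj₂ (separating i))) (∈-lookup j) agree
        where
        agree : ∀ {c} → c ∈ₛ D i → lookup (row i) c ≡ lookup (row j) c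
        agree c∈D with proj₂ (columns i) c∈D
        ... | q , refl = trace-agrees (row i) (row j) (proj₁ (columns i)) (proj₁ (columns j)) q
                           (funToFin-injective _ _ eq q)

    N≤[kW]^s : N T ≤ (k * W T) ^ s
    N≤[kW]^s = subst (_≤ (k * W T) ^ s) (length-map proj₁ (rows T))
                 (Unique⇒length≤ (rows-distinct T) code code-determines)

lemma10 : (k : ℕ) → 2 ≤ k → (T : Table k) → rows T ≢ [] →
    (s : ℕ) → IsS T s → N T ≤ (k * W T) ^ s
lemma10 k _ T _ s ((_ , _ , (D₀ , _ , ∣D₀∣≡s) , _) , S≤s) =
  N≤[kW]^s T (subst (_≤ W T) ∣D₀∣≡s (∣p∣≤n D₀)) S≤s
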